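{- Let $p$ be an odd prime, $n\ge1$ and $\alpha\in(\mathbb Z/p^n)^\times$. Let $D=\left\{\begin{pmatrix}\alpha^ka&b\\0&\alpha^{ -k}\end{pmatrix}:0\le k<o_\alpha,\ a\in(\mathbb Z/p^n)^\times,\ b\in\mathbb Z/p^n\right\}$ and $I=\left\{\begin{pmatrix}a&b\\0&1\end{pmatrix}:a\in(\mathbb Z/p^n)^\times,\ b\in\mathbb Z/p^n\right\}$, acting by left multiplication on $W=\left\{\binom{x}{y}:x,y\in\mathbb Z/p^n,\ v(x)=0\text{ or }v(y)=0\right\}$. For $w=\binom{x}{y}\in W$, $$\#D\cdot w=\begin{cases}o_{\bar\alpha}p^{2n-v_\alpha} & v(y)=0,\\ o_{\bar\alpha}(p-1)p^{\max\{2n-1-v_\alpha-v(y),\,n-1\}} & v(x)=0,\ 0<v(y)<n,\\ (p-1)p^{n-1} & v(x)=0,\ y=0,\end{cases}\qquad \#I\cdot w=\begin{cases}p^n & v(y)=0,\\ (p-1)p^{n-1} & v(x)=0,\ v(y)>0.\end{cases}$$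
   Context: For $x\in\mathbb Z/p^n$, $v(x)$ is the largest $e\le n$ with $p^e\mid x$ (so $v(0)=n$). $o_\alpha$ is the order of $\alpha$ in $(\mathbb Z/p^n)^\times$, $o_{\bar\alpha}$ the order of $\alpha\bmod p$ in $\mathbb F_p^\times$, and $v_\alpha=v(\alpha^{o_{\bar\alpha}}-1)$. -}

module Defs where

open import Data.Nat using (ℕ; zero; suc; _+_; _*_; _∸_; _^_; _≤_; _<_)
open import Data.Nat.DivMod using (_%_; _/_)
open import Data.Nat.Divisibility using (_∣?_)
open import Data.Nat.Properties using (_≟_)
open import Data.Nat.Coprimality using (Coprime; coprime?)
open import Data.Product using (_×_; _,_)
open import Data.Product.Properties using (≡-dec)
open import Data.List using (List; []; _∷_; length; map; filter; upTo; concatMap; deduplicate)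
open import Relation.Nullary using (yes; no; ¬_)
open import Relation.Binary.PropositionalEquality using (_≡_)

-- reduction modulo m (x mod 0 = x, never used with m = 0)
_mod_ : ℕ → ℕ → ℕ
x mod zero = x
x mod suc m = x % suc m

-- v(x) for x ∈ ℤ/p^n: largest e ≤ n with p^e ∣ x  (so v(0) = n)
val : (p n x : ℕ) → ℕ
val zero n x = 0
val (suc q) zero x = 0
val (suc q) (suc n) x with suc q ∣? x
... | yes _ = suc (val (suc q) n (x / suc q))
... | no _ = 0

residues : ℕ → List ℕ
residues N = upTo N

units : ℕ → List ℕ
units N = filter (λ a → coprime? a N) (upTo N)

IsOrder : (N α o : ℕ) → Set
IsOrder N α o = (1 ≤ o) × (((α ^ o) mod N) ≡ 1) ×
  ((k : ℕ) → 1 ≤ k → k < o → ¬ (((α ^ k) mod N) ≡ 1))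

card : List (ℕ × ℕ) → ℕ
card xs = length (deduplicate (≡-dec _≟_ _≟_) xs)

-- the orbit D·w, where β = α⁻¹ in ℤ/N and oα = order of α:
-- matrices (α^k a, b ; 0, α^{-k}) with 0 ≤ k < oα, a unit, b arbitrary
orbitD : (N α β oα x y : ℕ) → List (ℕ × ℕ)
orbitD N α β oα x y =
  concatMap (λ k → concatMap (λ a → map (λ b →
      ((α ^ k * a * x + b * y) mod N) , ((β ^ k * y) mod N))
    (residues N)) (units N)) (upTo oα)

orbitI : (N x y : ℕ) → List (ℕ × ℕ)
orbitI N x y =
  concatMap (λ a → map (λ b → ((a * x + b * y) mod N) , (y mod N))
    (residues N)) (units N)

-- For each k the first coordinate
-- ranges over the same set F: all of ℤ/pⁿ when y is a unit (solve for b), and the units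
-- when x is a unit and p ∣ y (solve for a).  So D·w is F × {βᵏ y}, and I·w is F × {y}.
-- For y = pᵉ y′ with y′ a unit, βⁱ y ≡ βʲ y (mod pⁿ) iff α^(j-i) ≡ 1 (mod p^(n-e)), so the
-- second factor has as many elements as the order of α modulo p^(n-e).  Writing
-- α^oᾱ = 1 + g with v(g) = vα, lifting the exponent (p odd) gives
-- v((1 + g)ʲ - 1) = vα + v(j), hence that order is oᾱ · p^max(n-e-vα, 0).

module Submission where

open import Defs
open import Data.Nat using (ℕ; zero; suc; _+_; _*_; _∸_; _^_; _<_; _≤_; _⊔_; z≤n; s≤s; NonZero; nonTrivial⇒n>1; >-nonZero; ≢-nonZero)
open import Data.Nat.Properties
open import Data.Nat.Divisibility
open import Data.Nat.DivMod
  using (_%_; _/_; m≡m%n+[m/n]*n; %-distribˡ-+; %-distribˡ-*; %-remove-+ʳ; [m+kn]%n≡m%n; [m+n]%n≡m%n;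
         m%n%n≡m%n; m%n<n; m%n≤m; m<n⇒m%n≡m; m*[n/m]≡n)
open import Data.Nat.Primality using (Prime; euclidsLemma; prime⇒nonZero; prime⇒nonTrivial; prime⇒irreducible)
open import Data.Nat.Coprimality using (Coprime; coprime?; coprime-divisor; coprime-Bézout) renaming (sym to Coprime-sym)
open import Data.Nat.GCD using (module Bézout)
open import Data.Nat.Tactic.RingSolver using (solve-∀)
open import Data.Product using (_×_; _,_; proj₁; proj₂; ∃-syntax)
open import Data.Product.Properties using (≡-dec)
open import Data.Sum using (_⊎_; inj₁; inj₂)
open import Data.Empty using (⊥-elim)
open import Data.List using (List; []; _∷_; [_]; _++_; length; map; filter; applyUpTo; upTo; cartesianProduct)
open import Data.List.Properties using (filter-++; filter-reject; filter-all; filter-≐; length-++; length-map; length-applyUpTo; length-upTo)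
open import Data.List.Membership.Propositional using (_∈_; find; lose)
open import Data.List.Membership.Propositional.Properties
  using (∈-filter⁺; ∈-filter⁻; ∈-upTo⁺; ∈-upTo⁻; ∈-applyUpTo⁺; ∈-applyUpTo⁻; ∈-cartesianProduct⁺; ∈-cartesianProduct⁻;
         ∈-deduplicate⁺; ∈-deduplicate⁻; ∈-concatMap⁺; ∈-concatMap⁻; ∈-map⁺; ∈-map⁻)
open import Data.List.Membership.Propositional.Properties.WithK using (unique∧set⇒bag)
open import Data.List.Relation.Unary.Any using (here)
import Data.List.Relation.Unary.All as All
import Data.List.Relation.Unary.All.Properties as All
import Data.List.Relation.Unary.AllPairs as AllPairs
open import Data.List.Relation.Unary.Unique.Propositional using (Unique)
import Data.List.Relation.Unary.Unique.Propositional.Properties as Unique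
open import Data.List.Relation.Unary.Unique.DecPropositional.Properties using (deduplicate-!)
open import Data.List.Relation.Binary.BagAndSetEquality using (∼bag⇒↭)
open import Data.List.Relation.Binary.Permutation.Propositional.Properties using (↭-length)
open import Function using (_∘_; id)
open import Function.Bundles using (_⇔_; mk⇔; module Equivalence)
open import Function.Properties.Equivalence using () renaming (trans to ⇔-trans)
open import Relation.Nullary using (¬_; Dec; yes; no; ¬?)
open import Relation.Binary.Definitions using (DecidableEquality)
open import Relation.Binary.Bundles using (Setoid)
import Relation.Binary.Construct.On as On
import Relation.Binary.Reasoning.Setoid as SetoidReasoning
open import Relation.Binary.PropositionalEquality
  using (_≡_; _≢_; refl; sym; trans; cong; cong₂; subst; subst₂; setoid; module ≡-Reasoning)

-- Congruences

mod≡% : ∀ x M .{{_ : NonZero M}} → x mod M ≡ x % M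
mod≡% x (suc M) = refl

module Congruence (M : ℕ) .{{_ : NonZero M}} where

  infix 4 _≈_
  _≈_ : ℕ → ℕ → Set
  a ≈ b = a % M ≡ b % M

  ≈-setoid : Setoid _ _
  ≈-setoid = On.setoid (setoid ℕ) (_% M)

  module ≈-Reasoning = SetoidReasoning ≈-setoid

  ≈-+ˡ : ∀ c {a b} → a ≈ b → c + a ≈ c + b
  ≈-+ˡ c {a} {b} a≈b = begin
    (c + a) % M            ≡⟨ %-distribˡ-+ c a M ⟩
    (c % M + a % M) % M    ≡⟨ cong (λ r → (c % M + r) % M) a≈b ⟩
    (c % M + b % M) % M    ≡⟨ %-distribˡ-+ c b M ⟨
    (c + b) % M            ∎
    where open ≡-Reasoning

  ≈-*ˡ : ∀ c {a b} → a ≈ b → c * a ≈ c * b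
  ≈-*ˡ c {a} {b} a≈b = begin
    (c * a) % M            ≡⟨ %-distribˡ-* c a M ⟩
    (c % M * (a % M)) % M  ≡⟨ cong (λ r → (c % M * r) % M) a≈b ⟩
    (c % M * (b % M)) % M  ≡⟨ %-distribˡ-* c b M ⟨
    (c * b) % M            ∎
    where open ≡-Reasoning

  ≈-*ʳ : ∀ c {a b} → a ≈ b → a * c ≈ b * c
  ≈-*ʳ c {a} {b} a≈b = subst₂ _≈_ (*-comm c a) (*-comm c b) (≈-*ˡ c a≈b)

  %-≈ : ∀ a → a % M ≈ a
  %-≈ a = m%n%n≡m%n a M

  +-multiple-≈ : ∀ a {b} → M ∣ b → a + b ≈ a
  +-multiple-≈ a M∣b = %-remove-+ʳ a M∣b

  +≈⇒∣ : ∀ a b → a + b ≈ a → M ∣ b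
  +≈⇒∣ a b a+b≈a = divides (q₁ ∸ q₂) (begin
    b                                      ≡⟨ m+n∸m≡n a b ⟨
    (a + b) ∸ a                            ≡⟨ cong₂ _∸_ (m≡m%n+[m/n]*n (a + b) M) (m≡m%n+[m/n]*n a M) ⟩
    ((a + b) % M + q₁ * M) ∸ (a % M + q₂ * M) ≡⟨ cong (λ r → (r + q₁ * M) ∸ (a % M + q₂ * M)) a+b≈a ⟩
    (a % M + q₁ * M) ∸ (a % M + q₂ * M)    ≡⟨ [m+n]∸[m+o]≡n∸o (a % M) (q₁ * M) (q₂ * M) ⟩
    q₁ * M ∸ q₂ * M                        ≡⟨ *-distribʳ-∸ M q₁ q₂ ⟨
    (q₁ ∸ q₂) * M                          ∎)
    where
    open ≡-Reasoning
    q₁ q₂ : ℕ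
    q₁ = (a + b) / M
    q₂ = a / M

  ∣-resp-≈ : ∀ {d a b} → d ∣ M → d ∣ a → a ≈ b → d ∣ b
  ∣-resp-≈ d∣M d∣a a≈b = ∣n∣m%n⇒∣m d∣M (subst (_ ∣_) a≈b (%-presˡ-∣ d∣a d∣M))

  ^-≈1 : ∀ {a} k → a ≈ 1 → a ^ k ≈ 1
  ^-≈1 zero    a≈1 = refl
  ^-≈1 {a} (suc k) a≈1 = begin
    a * a ^ k  ≈⟨ ≈-*ˡ a (^-≈1 k a≈1) ⟩
    a * 1      ≡⟨ *-identityʳ a ⟩
    a          ≈⟨ a≈1 ⟩
    1          ∎
    where open ≈-Reasoning

mod≡1⇔%≡1% : ∀ {M a} .{{_ : NonZero M}} → 1 < M → a mod M ≡ 1 ⇔ a % M ≡ 1 % M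
mod≡1⇔%≡1% {M} {a} 1<M = mk⇔ (λ eq → trans (sym (mod≡% a M)) (trans eq (sym 1%M≡1)))
                             (λ eq → trans (mod≡% a M) (trans eq 1%M≡1))
  where
  1%M≡1 : 1 % M ≡ 1
  1%M≡1 = m<n⇒m%n≡m 1<M

module _ {M : ℕ} .{{_ : NonZero M}} (1<M : 1 < M) {α o : ℕ} (o-order : IsOrder M α o) where

  open Congruence M

  private instance
    o≢0 : NonZero o
    o≢0 = >-nonZero (proj₁ o-order)

  ^-order≈1 : α ^ o ≈ 1
  ^-order≈1 = Equivalence.to (mod≡1⇔%≡1% 1<M) (proj₁ (proj₂ o-order))

  order-∣ : ∀ d → α ^ d ≈ 1 → o ∣ d
  order-∣ d α^d≈1 with d % o in d%o≡r
  ... | zero  = m%n≡0⇒n∣m d o d%o≡r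
  ... | suc r = ⊥-elim (proj₂ (proj₂ o-order) (suc r) (s≤s z≤n) (subst (_< o) d%o≡r (m%n<n d o))
                  (Equivalence.from (mod≡1⇔%≡1% 1<M) α^[1+r]≈1))
    where
    q : ℕ
    q = d / o
    α^[1+r]≈1 : α ^ suc r ≈ 1
    α^[1+r]≈1 = begin
      α ^ suc r                   ≡⟨ *-identityʳ (α ^ suc r) ⟨
      α ^ suc r * 1               ≈⟨ ≈-*ˡ (α ^ suc r) (^-≈1 q ^-order≈1) ⟨
      α ^ suc r * (α ^ o) ^ q     ≡⟨ cong (α ^ suc r *_) (^-*-assoc α o q) ⟩
      α ^ suc r * α ^ (o * q)     ≡⟨ ^-distribˡ-+-* α (suc r) (o * q) ⟨
      α ^ (suc r + o * q)         ≡⟨ cong (α ^_) d≡ ⟨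
      α ^ d                       ≈⟨ α^d≈1 ⟩
      1                           ∎
      where
      open ≈-Reasoning
      d≡ : d ≡ suc r + o * q
      d≡ = trans (m≡m%n+[m/n]*n d o) (cong₂ _+_ d%o≡r (*-comm q o))

module InverseOrbit (N : ℕ) .{{_ : NonZero N}} {α β : ℕ} (αβ≈1 : (α * β) % N ≡ 1 % N) where

  open Congruence N

  αᵏβᵏ≈1 : ∀ k → α ^ k * β ^ k ≈ 1
  αᵏβᵏ≈1 zero    = refl
  αᵏβᵏ≈1 (suc k) = begin
    α * α ^ k * (β * β ^ k)    ≡⟨ regroup α (α ^ k) β (β ^ k) ⟩
    α * β * (α ^ k * β ^ k)    ≈⟨ ≈-*ˡ (α * β) (αᵏβᵏ≈1 k) ⟩
    α * β * 1                  ≡⟨ *-identityʳ (α * β) ⟩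
    α * β                      ≈⟨ αβ≈1 ⟩
    1                          ∎
    where
    open ≈-Reasoning
    regroup : ∀ a b c d → a * b * (c * d) ≡ a * c * (b * d)
    regroup = solve-∀

  β-orbit≈⇔ : ∀ {c M y′} .{{_ : NonZero c}} → N ≡ c * M → Coprime y′ M →
    ∀ {i j X} → i ≤ j → α ^ (j ∸ i) ≡ 1 + X → β ^ i * (c * y′) ≈ β ^ j * (c * y′) ⇔ M ∣ X
  β-orbit≈⇔ {c} {M} {y′} N≡cM y′⊥M {i} {j} {X} i≤j α^d≡1+X = mk⇔ to from
    where
    d y : ℕ
    d = j ∸ i
    y = c * y′
    j≡d+i : j ≡ d + i
    j≡d+i = sym (m∸n+n≡m i≤j)
    to : β ^ i * y ≈ β ^ j * y → M ∣ X
    to βⁱy≈βʲy = coprime-divisor (Coprime-sym y′⊥M) (*-cancelˡ-∣ c (subst₂ _∣_ N≡cM (*-assoc c y′ X) N∣yX))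
      where
      open ≈-Reasoning
      y+yX≈y : y + y * X ≈ y
      y+yX≈y = begin
        y + y * X                    ≡⟨ factor y X ⟩
        y * (1 + X)                  ≡⟨ cong (y *_) α^d≡1+X ⟨
        y * α ^ d                    ≡⟨ *-identityˡ (y * α ^ d) ⟨
        1 * (y * α ^ d)              ≈⟨ ≈-*ʳ (y * α ^ d) (αᵏβᵏ≈1 i) ⟨
        α ^ i * β ^ i * (y * α ^ d)  ≡⟨ regroup (α ^ i) (β ^ i) y (α ^ d) ⟩
        α ^ d * α ^ i * (β ^ i * y)  ≡⟨ cong (_* (β ^ i * y)) (^-distribˡ-+-* α d i) ⟨
        α ^ (d + i) * (β ^ i * y)    ≡⟨ cong (λ k → α ^ k * (β ^ i * y)) j≡d+i ⟨
        α ^ j * (β ^ i * y)          ≈⟨ ≈-*ˡ (α ^ j) βⁱy≈βʲy ⟩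
        α ^ j * (β ^ j * y)          ≡⟨ *-assoc (α ^ j) (β ^ j) y ⟨
        α ^ j * β ^ j * y            ≈⟨ ≈-*ʳ y (αᵏβᵏ≈1 j) ⟩
        1 * y                        ≡⟨ *-identityˡ y ⟩
        y                            ∎
        where
        factor : ∀ y X → y + y * X ≡ y * (1 + X)
        factor = solve-∀
        regroup : ∀ a b y c → a * b * (y * c) ≡ c * a * (b * y)
        regroup = solve-∀
      N∣yX : N ∣ y * X
      N∣yX = +≈⇒∣ y (y * X) y+yX≈y
    from : M ∣ X → β ^ i * y ≈ β ^ j * y
    from M∣X = begin
      β ^ i * y                           ≡⟨ *-identityʳ (β ^ i * y) ⟨
      β ^ i * y * 1                       ≈⟨ ≈-*ˡ (β ^ i * y) (αᵏβᵏ≈1 d) ⟨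
      β ^ i * y * (α ^ d * β ^ d)         ≡⟨ regroup (β ^ i) y (α ^ d) (β ^ d) ⟩
      β ^ d * β ^ i * y * α ^ d           ≡⟨ cong (λ b → b * y * α ^ d) (^-distribˡ-+-* β d i) ⟨
      β ^ (d + i) * y * α ^ d             ≡⟨ cong₂ (λ k a → β ^ k * y * a) (sym j≡d+i) α^d≡1+X ⟩
      β ^ j * y * (1 + X)                 ≡⟨ expand (β ^ j) y X ⟩
      β ^ j * y + β ^ j * (y * X)         ≈⟨ +-multiple-≈ (β ^ j * y) (∣n⇒∣m*n (β ^ j) N∣yX) ⟩
      β ^ j * y                           ∎
      where
      open ≈-Reasoning
      regroup : ∀ b y a c → b * y * (a * c) ≡ c * b * y * a
      regroup = solve-∀
      expand : ∀ b y X → b * y * (1 + X) ≡ b * y + b * (y * X)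
      expand = solve-∀
      N∣yX : N ∣ y * X
      N∣yX = subst₂ _∣_ (sym N≡cM) (sym (*-assoc c y′ X)) (*-monoʳ-∣ c (∣n⇒∣m*n y′ M∣X))

-- Units modulo a prime power

applyUpTo-++ : ∀ {a} {A : Set a} (f : ℕ → A) m n →
  applyUpTo f (m + n) ≡ applyUpTo f m ++ applyUpTo (f ∘ (m +_)) n
applyUpTo-++ f zero    n = refl
applyUpTo-++ f (suc m) n = cong (f 0 ∷_) (applyUpTo-++ (f ∘ suc) m n)

units-unique : ∀ N → Unique (units N)
units-unique N = Unique.filter⁺ (λ a → coprime? a N) (Unique.upTo⁺ N)

module PrimePower (p : ℕ) (p-prime : Prime p) where

  instance
    p≢0 : NonZero p
    p≢0 = prime⇒nonZero p-prime

  1<p : 1 < p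
  1<p = nonTrivial⇒n>1 p {{prime⇒nonTrivial p-prime}}

  p∤1 : ¬ p ∣ 1
  p∤1 p∣1 = <⇒≢ 1<p (sym (∣1⇒≡1 p∣1))

  ∤-* : ∀ {a b} → ¬ p ∣ a → ¬ p ∣ b → ¬ p ∣ a * b
  ∤-* {a} {b} p∤a p∤b p∣ab with euclidsLemma a b p-prime p∣ab
  ... | inj₁ p∣a = p∤a p∣a
  ... | inj₂ p∣b = p∤b p∣b

  ∤-^ : ∀ {a} k → ¬ p ∣ a → ¬ p ∣ a ^ k
  ∤-^ zero    p∤a = p∤1
  ∤-^ (suc k) p∤a = ∤-* p∤a (∤-^ k p∤a)

  p∣p^suc : ∀ n → p ∣ p ^ suc n
  p∣p^suc n = m∣m*n (p ^ n)

  p∣pᵐ : ∀ {m} → 1 ≤ m → p ∣ p ^ m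
  p∣pᵐ {suc m} _ = p∣p^suc m

  ^-monoʳ-∣ : ∀ {m n} → m ≤ n → p ^ m ∣ p ^ n
  ^-monoʳ-∣ {m} {n} m≤n = divides (p ^ (n ∸ m)) (begin
    p ^ n              ≡⟨ cong (p ^_) (m+[n∸m]≡n m≤n) ⟨
    p ^ (m + (n ∸ m))  ≡⟨ ^-distribˡ-+-* p m (n ∸ m) ⟩
    p ^ m * p ^ (n ∸ m) ≡⟨ *-comm (p ^ m) _ ⟩
    p ^ (n ∸ m) * p ^ m ∎)
    where open ≡-Reasoning

  ∤⇒coprime-^ : ∀ n {a} → ¬ p ∣ a → Coprime a (p ^ n)
  ∤⇒coprime-^ zero    p∤a (_ , d∣1) = ∣1⇒≡1 d∣1
  ∤⇒coprime-^ (suc n) p∤a {d} (d∣a , d∣p^suc) with p ∣? d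
  ... | yes p∣d = ⊥-elim (p∤a (∣-trans p∣d d∣a))
  ... | no  p∤d = ∤⇒coprime-^ n p∤a (d∣a , coprime-divisor d⊥p d∣p^suc)
    where
    d⊥p : Coprime d p
    d⊥p (e∣d , e∣p) with prime⇒irreducible p-prime e∣p
    ... | inj₁ e≡1 = e≡1
    ... | inj₂ refl = ⊥-elim (p∤d e∣d)

  coprime-^⇒∤ : ∀ n {a} → Coprime a (p ^ suc n) → ¬ p ∣ a
  coprime-^⇒∤ n a⊥p^n p∣a = p∤1 (subst (p ∣_) (a⊥p^n (p∣a , p∣p^suc n)) ∣-refl)

  ∈-units⁺ : ∀ n {a} → a < p ^ n → ¬ p ∣ a → a ∈ units (p ^ n)
  ∈-units⁺ n a<N p∤a = ∈-filter⁺ (λ a → coprime? a (p ^ n)) (∈-upTo⁺ a<N) (∤⇒coprime-^ n p∤a)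

  ∈-units⁻ : ∀ n {a} → a ∈ units (p ^ suc n) → a < p ^ suc n × ¬ p ∣ a
  ∈-units⁻ n a∈ = let (a∈upTo , a⊥N) = ∈-filter⁻ (λ a → coprime? a (p ^ suc n)) a∈
                  in ∈-upTo⁻ a∈upTo , coprime-^⇒∤ n a⊥N

  ∤? : ∀ a → Dec (¬ p ∣ a)
  ∤? a = ¬? (p ∣? a)

  length-filter-∤-block : ∀ k (f : ℕ → ℕ) → (∀ i → p ∣ f i ⇔ p ∣ i) → k < p →
    length (filter ∤? (applyUpTo f (suc k))) ≡ k
  length-filter-∤-block k f f-resp k<p = begin
    length (filter ∤? (f 0 ∷ applyUpTo (f ∘ suc) k)) ≡⟨ cong length (filter-reject ∤? (λ p∤f0 → p∤f0 p∣f0)) ⟩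
    length (filter ∤? (applyUpTo (f ∘ suc) k))       ≡⟨ cong length (filter-all ∤? (All.applyUpTo⁺₁ (f ∘ suc) k p∤f[1+i])) ⟩
    length (applyUpTo (f ∘ suc) k)                   ≡⟨ length-applyUpTo (f ∘ suc) k ⟩
    k                                                ∎
    where
    open ≡-Reasoning
    p∣f0 : p ∣ f 0
    p∣f0 = Equivalence.from (f-resp 0) (p ∣0)
    p∤f[1+i] : ∀ {i} → i < k → ¬ p ∣ f (suc i)
    p∤f[1+i] {i} i<k p∣f = <⇒≱ (≤-trans (s≤s i<k) k<p) (∣⇒≤ (Equivalence.to (f-resp (suc i)) p∣f))

  length-filter-∤ : ∀ M (f : ℕ → ℕ) → (∀ i → p ∣ f i ⇔ p ∣ i) →
    length (filter ∤? (applyUpTo f (p * M))) ≡ (p ∸ 1) * M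
  length-filter-∤ zero    f f-resp rewrite *-zeroʳ p | *-zeroʳ (p ∸ 1) = refl
  length-filter-∤ (suc M) f f-resp = begin
    length (filter ∤? (applyUpTo f (p * suc M)))  ≡⟨ cong (λ k → length (filter ∤? (applyUpTo f k))) (*-suc p M) ⟩
    length (filter ∤? (applyUpTo f (p + p * M)))  ≡⟨ cong (length ∘ filter ∤?) (applyUpTo-++ f p (p * M)) ⟩
    length (filter ∤? (applyUpTo f p ++ applyUpTo (f ∘ (p +_)) (p * M)))
      ≡⟨ cong length (filter-++ ∤? (applyUpTo f p) _) ⟩
    length (filter ∤? (applyUpTo f p) ++ filter ∤? (applyUpTo (f ∘ (p +_)) (p * M)))
      ≡⟨ length-++ (filter ∤? (applyUpTo f p)) ⟩
    length (filter ∤? (applyUpTo f p)) + length (filter ∤? (applyUpTo (f ∘ (p +_)) (p * M)))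
      ≡⟨ cong₂ _+_ block (length-filter-∤ M (f ∘ (p +_)) shifted-resp) ⟩
    (p ∸ 1) + (p ∸ 1) * M                         ≡⟨ *-suc (p ∸ 1) M ⟨
    (p ∸ 1) * suc M                               ∎
    where
    open ≡-Reasoning
    p≡1+[p∸1] : p ≡ suc (p ∸ 1)
    p≡1+[p∸1] = sym (m+[n∸m]≡n (<⇒≤ 1<p))
    block : length (filter ∤? (applyUpTo f p)) ≡ p ∸ 1
    block = subst (λ k → length (filter ∤? (applyUpTo f k)) ≡ p ∸ 1) (sym p≡1+[p∸1])
      (length-filter-∤-block (p ∸ 1) f f-resp (subst (p ∸ 1 <_) (sym p≡1+[p∸1]) ≤-refl))
    shifted-resp : ∀ i → p ∣ f (p + i) ⇔ p ∣ i
    shifted-resp i = mk⇔ (λ p∣f[p+i] → ∣m+n∣m⇒∣n (Equivalence.to (f-resp (p + i)) p∣f[p+i]) ∣-refl)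
                         (λ p∣i → Equivalence.from (f-resp (p + i)) (∣m∣n⇒∣m+n ∣-refl p∣i))

  length-units : ∀ n → length (units (p ^ suc n)) ≡ (p ∸ 1) * p ^ n
  length-units n = trans
    (cong length (filter-≐ (λ a → coprime? a N) ∤? (coprime-^⇒∤ n , ∤⇒coprime-^ (suc n)) (upTo N)))
    (length-filter-∤ (p ^ n) id (λ _ → mk⇔ id id))
    where
    N : ℕ
    N = p ^ suc n

  module Residues (n : ℕ) where

    N : ℕ
    N = p ^ suc n

    instance
      N≢0 : NonZero N
      N≢0 = m^n≢0 p (suc n)

    N′ : ℕ
    N′ = N ∸ 1

    N≡1+N′ : N ≡ suc N′
    N≡1+N′ = sym (m+[n∸m]≡n (m^n>0 p (suc n)))

    open Congruence N

    inverse : ∀ {c} → ¬ p ∣ c → ∃[ z ] c * z ≈ 1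
    inverse {c} p∤c with coprime-Bézout (∤⇒coprime-^ (suc n) p∤c)
    ... | Bézout.+- x y 1+yN≡xc = x , (begin
      c * x      ≡⟨ *-comm c x ⟩
      x * c      ≡⟨ 1+yN≡xc ⟨
      1 + y * N  ≈⟨ [m+kn]%n≡m%n 1 y N ⟩
      1          ∎)
      where open ≈-Reasoning
    ... | Bézout.-+ x y 1+xc≡yN = x * N′ , (begin
      c * (x * N′)                   ≈⟨ [m+kn]%n≡m%n (c * (x * N′)) y N ⟨
      c * (x * N′) + y * N           ≡⟨ cong (c * (x * N′) +_) 1+xc≡yN ⟨
      c * (x * N′) + (1 + x * c)     ≡⟨ regroup c x N′ ⟩
      1 + (x * c) * suc N′           ≡⟨ cong (λ k → 1 + (x * c) * k) N≡1+N′ ⟨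
      1 + (x * c) * N                ≈⟨ [m+kn]%n≡m%n 1 (x * c) N ⟩
      1                              ∎)
      where
      open ≈-Reasoning
      regroup : ∀ c x N′ → c * (x * N′) + (1 + x * c) ≡ 1 + (x * c) * suc N′
      regroup = solve-∀

    residue-reachable : ∀ {y} → ¬ p ∣ y → ∀ c {u} → u < N → ∃[ b ] b < N × (c + b * y) % N ≡ u
    residue-reachable {y} p∤y c {u} u<N = let (z , yz≈1) = inverse p∤y; w = u + N′ * c in
      (w * z) % N , m%n<n (w * z) N , trans (begin
        c + (w * z) % N * y   ≈⟨ ≈-+ˡ c (≈-*ʳ y (%-≈ (w * z))) ⟩
        c + w * z * y         ≡⟨ cong (c +_) (trans (*-assoc w z y) (cong (w *_) (*-comm z y))) ⟩
        c + w * (y * z)       ≈⟨ ≈-+ˡ c (≈-*ˡ w yz≈1) ⟩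
        c + w * 1             ≡⟨ regroup c u N′ ⟩
        u + c * suc N′        ≡⟨ cong (λ k → u + c * k) N≡1+N′ ⟨
        u + c * N             ≈⟨ [m+kn]%n≡m%n u c N ⟩
        u                     ∎) (m<n⇒m%n≡m u<N)
      where
      open ≈-Reasoning
      regroup : ∀ c u N′ → c + (u + N′ * c) * 1 ≡ u + c * suc N′
      regroup = solve-∀

    unit-reachable : ∀ {c} → ¬ p ∣ c → ∀ {u} → u ∈ units N → ∃[ a ] a ∈ units N × (a * c) % N ≡ u
    unit-reachable {c} p∤c {u} u∈ = let (z , cz≈1) = inverse p∤c; (u<N , p∤u) = ∈-units⁻ n u∈ in
      (u * z) % N , ∈-units⁺ (suc n) (m%n<n (u * z) N) (p∤[uz]%N p∤u cz≈1) , trans (begin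
        (u * z) % N * c   ≈⟨ ≈-*ʳ c (%-≈ (u * z)) ⟩
        u * z * c         ≡⟨ trans (*-assoc u z c) (cong (u *_) (*-comm z c)) ⟩
        u * (c * z)       ≈⟨ ≈-*ˡ u cz≈1 ⟩
        u * 1             ≡⟨ *-identityʳ u ⟩
        u                 ∎) (m<n⇒m%n≡m u<N)
      where
      open ≈-Reasoning
      p∣N : p ∣ N
      p∣N = p∣p^suc n
      p∤[uz]%N : ∀ {u z} → ¬ p ∣ u → c * z ≈ 1 → ¬ p ∣ (u * z) % N
      p∤[uz]%N {u} {z} p∤u cz≈1 p∣[uz]%N = ∤-* p∤u p∤z (∣n∣m%n⇒∣m p∣N p∣[uz]%N)
        where p∤z : ¬ p ∣ z
              p∤z p∣z = p∤1 (∣-resp-≈ p∣N (∣n⇒∣m*n c p∣z) cz≈1)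

    ∤-+-∣∈units : ∀ {u v} → ¬ p ∣ u → p ∣ v → (u + v) % N ∈ units N
    ∤-+-∣∈units {u} {v} p∤u p∣v = ∈-units⁺ (suc n) (m%n<n (u + v) N) λ p∣[u+v]%N →
      p∤u (∣m+n∣m⇒∣n (subst (p ∣_) (+-comm u v) (∣n∣m%n⇒∣m (p∣p^suc n) p∣[u+v]%N)) p∣v)

-- Valuations

infix 4 _^_∥_

record _^_∥_ (p v x : ℕ) : Set where
  constructor exactly
  field
    cofactor   : ℕ
    x≡         : x ≡ p ^ v * cofactor
    p∤cofactor : ¬ p ∣ cofactor

-- v = min(v_p(x), n); this is what val p n x computes.
TruncatedValuation : ℕ → ℕ → ℕ → ℕ → Set
TruncatedValuation p n x v = (v ≡ n × p ^ n ∣ x) ⊎ (v < n × p ^ v ∥ x)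

truncatedValuation-≤ : ∀ {p n x v} → TruncatedValuation p n x v → v ≤ n
truncatedValuation-≤ (inj₁ (refl , _)) = ≤-refl
truncatedValuation-≤ (inj₂ (v<n , _))  = <⇒≤ v<n

val-truncated : ∀ p .{{_ : NonZero p}} n x → TruncatedValuation p n x (val p n x)
val-truncated (suc q) zero    x = inj₁ (refl , 1∣ x)
val-truncated (suc q) (suc n) x with suc q ∣? x
... | no  p∤x = inj₂ (s≤s z≤n , exactly x (sym (*-identityˡ x)) p∤x)
... | yes p∣x with val-truncated (suc q) n (x / suc q)
...   | inj₁ (v≡n , pⁿ∣x/p) = inj₁ (cong suc v≡n , subst (_ ∣_) (m*[n/m]≡n p∣x) (*-monoʳ-∣ (suc q) pⁿ∣x/p))
...   | inj₂ (v<n , exactly w x/p≡pᵛw p∤w) = inj₂ (s≤s v<n , exactly w x≡ p∤w)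
  where
  x≡ : x ≡ suc q ^ suc (val (suc q) n (x / suc q)) * w
  x≡ = trans (sym (m*[n/m]≡n p∣x))
         (trans (cong (suc q *_) x/p≡pᵛw) (sym (*-assoc (suc q) (suc q ^ val (suc q) n (x / suc q)) w)))

module _ (p : ℕ) .{{_ : NonZero p}} where

  ∥⇒∣ : ∀ {v x} → p ^ v ∥ x → p ^ v ∣ x
  ∥⇒∣ {v} (exactly w refl _) = m∣m*n w

  ∥⇒∤ : ∀ {v x} → p ^ v ∥ x → ¬ p ^ suc v ∣ x
  ∥⇒∤ {v} (exactly w refl p∤w) p^[1+v]∣x =
    p∤w (*-cancelˡ-∣ (p ^ v) {{m^n≢0 p v}} (subst (_∣ p ^ v * w) (*-comm p (p ^ v)) p^[1+v]∣x))

  ∥⇒p∣ : ∀ {v x} → p ^ suc v ∥ x → p ∣ x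
  ∥⇒p∣ {v} p^[1+v]∥x = ∣-trans (m∣m*n (p ^ v)) (∥⇒∣ p^[1+v]∥x)

  val≡0⇒∤ : ∀ n x → val p (suc n) x ≡ 0 → ¬ p ∣ x
  val≡0⇒∤ n x v≡0 with val-truncated p (suc n) x
  ... | inj₁ (v≡1+n , _)         = ⊥-elim (0≢1+n (trans (sym v≡0) v≡1+n))
  ... | inj₂ (_ , exactly w x≡ p∤w) = λ p∣x → p∤w (subst (p ∣_) x≡w p∣x)
    where
    x≡w : x ≡ w
    x≡w = trans x≡ (trans (cong (λ k → p ^ k * w) v≡0) (*-identityˡ w))

  val>0⇒∣ : ∀ n x → 0 < val p n x → p ∣ x
  val>0⇒∣ n x v>0 with val p n x | val-truncated p n x
  val>0⇒∣ n x (s≤s _) | suc v | inj₁ (refl , pⁿ∣x)        = ∣-trans (m∣m*n (p ^ v)) pⁿ∣x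
  val>0⇒∣ n x (s≤s _) | suc v | inj₂ (_ , exactly w refl _) = ∣-trans (m∣m*n (p ^ v)) (m∣m*n w)

  ∥-+-∣ : ∀ {n v a b} → v < n → p ^ v ∥ a → p ^ n ∣ b → p ^ v ∥ a + b
  ∥-+-∣ {n} {v} {a} {b} v<n (exactly w refl p∤w) (divides c refl) =
    exactly (w + c * p ^ (n ∸ v)) eq λ p∣sum →
      p∤w (∣m+n∣m⇒∣n (subst (p ∣_) (+-comm w _) p∣sum) (∣n⇒∣m*n c p∣p^[n∸v]))
    where
    p∣p^[n∸v] : p ∣ p ^ (n ∸ v)
    p∣p^[n∸v] = subst (λ k → p ∣ p ^ k) (m+[n∸m]≡n (m<n⇒0<n∸m v<n)) (m∣m*n _)
    eq : p ^ v * w + c * p ^ n ≡ p ^ v * (w + c * p ^ (n ∸ v))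
    eq = begin
      p ^ v * w + c * p ^ n                   ≡⟨ cong (λ k → p ^ v * w + c * p ^ k) (m+[n∸m]≡n (<⇒≤ v<n)) ⟨
      p ^ v * w + c * p ^ (v + (n ∸ v))       ≡⟨ cong (λ k → p ^ v * w + c * k) (^-distribˡ-+-* p v (n ∸ v)) ⟩
      p ^ v * w + c * (p ^ v * p ^ (n ∸ v))   ≡⟨ factor (p ^ v) w c (p ^ (n ∸ v)) ⟩
      p ^ v * (w + c * p ^ (n ∸ v))           ∎
      where
      open ≡-Reasoning
      factor : ∀ a w c b → a * w + c * (a * b) ≡ a * (w + c * b)
      factor = solve-∀

  module _ (n : ℕ) where

    private instance
      pⁿ≢0 : NonZero (p ^ n)
      pⁿ≢0 = m^n≢0 p n

    truncatedValuation-% : ∀ {x v} → TruncatedValuation p n (x % p ^ n) v → TruncatedValuation p n x v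
    truncatedValuation-% (inj₁ (v≡n , pⁿ∣x%pⁿ)) = inj₁ (v≡n , ∣n∣m%n⇒∣m ∣-refl pⁿ∣x%pⁿ)
    truncatedValuation-% {x} {v} (inj₂ (v<n , pᵛ∥x%pⁿ)) =
      inj₂ (v<n , subst (p ^ v ∥_) (sym (m≡m%n+[m/n]*n x (p ^ n))) (∥-+-∣ v<n pᵛ∥x%pⁿ (n∣m*n (x / p ^ n))))

val<⇒∥ : ∀ p .{{_ : NonZero p}} n x → val p n x < n → p ^ val p n x ∥ x
val<⇒∥ p n x v<n with val-truncated p n x
... | inj₁ (v≡n , _)     = ⊥-elim (<⇒≢ v<n v≡n)
... | inj₂ (_ , pᵛ∥x)    = pᵛ∥x

-- Lifting the exponent

geom : ℕ → ℕ → ℕ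
geom g zero    = 0
geom g (suc k) = 1 + (1 + g) * geom g k

^-geom : ∀ g k → (1 + g) ^ k ≡ 1 + g * geom g k
^-geom g zero    = cong suc (sym (*-zeroʳ g))
^-geom g (suc k) = trans (cong ((1 + g) *_) (^-geom g k)) (expand g (geom g k))
  where
  expand : ∀ g s → (1 + g) * (1 + g * s) ≡ 1 + g * (1 + (1 + g) * s)
  expand = solve-∀

geom-* : ∀ g m j → g * geom g (m * j) ≡ (g * geom g m) * geom (g * geom g m) j
geom-* g m j = suc-injective (begin
  1 + g * geom g (m * j)  ≡⟨ ^-geom g (m * j) ⟨
  (1 + g) ^ (m * j)       ≡⟨ ^-*-assoc (1 + g) m j ⟨
  ((1 + g) ^ m) ^ j       ≡⟨ cong (_^ j) (^-geom g m) ⟩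
  (1 + g * geom g m) ^ j  ≡⟨ ^-geom (g * geom g m) j ⟩
  1 + (g * geom g m) * geom (g * geom g m) j ∎)
  where open ≡-Reasoning

triangle : ℕ → ℕ
triangle zero    = 0
triangle (suc k) = triangle k + k

geom-expansion : ∀ g k → ∃[ r ] geom g k ≡ k + g * (triangle k + g * r)
geom-expansion g zero    = 0 , sym (trans (cong (g *_) (*-zeroʳ g)) (*-zeroʳ g))
geom-expansion g (suc k) with geom-expansion g k
... | r , eq = triangle k + r + g * r , trans (cong (λ s → 1 + (1 + g) * s) eq) (expand g k (triangle k) r)
  where
  expand : ∀ g k t r → 1 + (1 + g) * (k + g * (t + g * r)) ≡ suc k + g * ((t + k) + g * (t + r + g * r))
  expand = solve-∀

triangle-odd : ∀ h → triangle (suc (h + h)) ≡ suc (h + h) * h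
triangle-odd zero    = refl
triangle-odd (suc h) = begin
  triangle (suc (suc h + suc h))                             ≡⟨ cong (λ k → triangle (suc (suc k))) (+-suc h h) ⟩
  triangle (suc (h + h)) + suc (h + h) + suc (suc (h + h))
    ≡⟨ cong (λ t → t + suc (h + h) + suc (suc (h + h))) (triangle-odd h) ⟩
  suc (h + h) * h + suc (h + h) + suc (suc (h + h))          ≡⟨ expand h ⟩
  suc (suc h + suc h) * suc h                                ∎
  where
  open ≡-Reasoning
  expand : ∀ h → suc (h + h) * h + suc (h + h) + suc (suc (h + h)) ≡ suc (suc h + suc h) * suc h
  expand = solve-∀

module LiftingTheExponent (p : ℕ) (p-prime : Prime p) (p-odd : p % 2 ≡ 1) where

  open PrimePower p p-prime

  -- The only use of p being odd.
  p∣triangle[p] : p ∣ triangle p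
  p∣triangle[p] = divides h (begin
    triangle p              ≡⟨ cong triangle p≡1+2h ⟩
    triangle (suc (h + h))  ≡⟨ triangle-odd h ⟩
    suc (h + h) * h         ≡⟨ *-comm _ h ⟩
    h * suc (h + h)         ≡⟨ cong (h *_) p≡1+2h ⟨
    h * p                   ∎)
    where
    open ≡-Reasoning
    h : ℕ
    h = p / 2
    p≡1+2h : p ≡ suc (h + h)
    p≡1+2h = trans (m≡m%n+[m/n]*n p 2) (cong₂ _+_ p-odd (trans (*-comm h 2) (cong (h +_) (+-identityʳ h))))

  p∤1+p* : ∀ Y → ¬ p ∣ 1 + p * Y
  p∤1+p* Y p∣1+pY = p∤1 (∣m+n∣m⇒∣n (subst (p ∣_) (+-comm 1 (p * Y)) p∣1+pY) (m∣m*n Y))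

  ∤-geom : ∀ {g k} → p ∣ g → ¬ p ∣ k → ¬ p ∣ geom g k
  ∤-geom {g} {k} (divides c refl) p∤k p∣geom with geom-expansion (c * p) k
  ... | r , eq = p∤k (∣m+n∣m⇒∣n (subst (p ∣_) (trans eq (+-comm k _)) p∣geom)
                                 (divides (c * (triangle k + c * p * r)) (regroup c p _)))
    where
    regroup : ∀ c p s → c * p * s ≡ c * s * p
    regroup = solve-∀

  geom-p : ∀ {g} → p ∣ g → ∃[ Y ] geom g p ≡ p * (1 + p * Y)
  geom-p {g} (divides c refl) with geom-expansion (c * p) p | p∣triangle[p]
  ... | r , eq | divides h t≡hp = c * h + c * c * r , (begin
    geom (c * p) p                                  ≡⟨ eq ⟩
    p + c * p * (triangle p + c * p * r)            ≡⟨ cong (λ t → p + c * p * (t + c * p * r)) t≡hp ⟩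
    p + c * p * (h * p + c * p * r)                 ≡⟨ regroup p c h r ⟩
    p * (1 + p * (c * h + c * c * r))               ∎)
    where
    open ≡-Reasoning
    regroup : ∀ p c h r → p + c * p * (h * p + c * p * r) ≡ p * (1 + p * (c * h + c * c * r))
    regroup = solve-∀

  ∥-geom-coprime : ∀ {v g j} → p ∣ g → p ^ v ∥ g → ¬ p ∣ j → p ^ v ∥ g * geom g j
  ∥-geom-coprime {v} {g} {j} p∣g (exactly w refl p∤w) p∤j =
    exactly (w * geom g j) (*-assoc (p ^ v) w (geom g j)) (∤-* p∤w (∤-geom p∣g p∤j))

  ∥-geom-p : ∀ {v g} → p ^ suc v ∥ g → p ^ suc (suc v) ∥ g * geom g p
  ∥-geom-p {v} {g} pᵛ∥g@(exactly w refl p∤w) with geom-p (∥⇒p∣ p pᵛ∥g)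
  ... | Y , eq = exactly (w * (1 + p * Y)) (trans (cong (g *_) eq) (regroup p (p ^ v) w (1 + p * Y)))
                         (∤-* p∤w (p∤1+p* Y))
    where
    regroup : ∀ p a w z → p * a * w * (p * z) ≡ p * (p * a) * (w * z)
    regroup = solve-∀

  lte-exponent-divisible : ∀ t {v g j} → p ^ suc v ∥ g → p ^ (suc v + t) ∣ g * geom g j → p ^ t ∣ j
  lte-exponent-divisible zero    {j = j} _ _ = 1∣ j
  lte-exponent-divisible (suc t) {v} {g} {j} p^[1+v]∥g p^[1+v+1+t]∣ with p ∣? j
  ... | no p∤j = ⊥-elim (∥⇒∤ p (∥-geom-coprime (∥⇒p∣ p p^[1+v]∥g) p^[1+v]∥g p∤j)
                   (∣-trans (^-monoʳ-∣ (m≤m+n (suc (suc v)) t)) p^[2+v+t]∣))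
    where
    p^[2+v+t]∣ : p ^ (suc (suc v) + t) ∣ g * geom g j
    p^[2+v+t]∣ = subst (λ k → p ^ k ∣ g * geom g j) (+-suc (suc v) t) p^[1+v+1+t]∣
  ... | yes (divides j′ refl) = subst (p ^ suc t ∣_) (*-comm p j′)
          (*-monoʳ-∣ p (lte-exponent-divisible t (∥-geom-p p^[1+v]∥g)
            (subst₂ _∣_ (cong (p ^_) (+-suc (suc v) t))
              (trans (cong (λ k → g * geom g k) (*-comm j′ p)) (geom-* g p j′)) p^[1+v+1+t]∣)))

  lte-prime-power-exponent : ∀ t {v g} → p ^ suc v ∥ g → p ^ (suc v + t) ∣ g * geom g (p ^ t)
  lte-prime-power-exponent zero    {v} {g} p^[1+v]∥g =
    subst₂ _∣_ (cong (λ k → p ^ suc k) (sym (+-identityʳ v))) (sym g*geom[1]≡g) (∥⇒∣ p p^[1+v]∥g)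
    where
    g*geom[1]≡g : g * geom g 1 ≡ g
    g*geom[1]≡g = trans (cong (λ s → g * suc s) (*-zeroʳ (1 + g))) (*-identityʳ g)
  lte-prime-power-exponent (suc t) {v} {g} p^[1+v]∥g =
    subst₂ _∣_ (cong (p ^_) (sym (+-suc (suc v) t))) (sym (geom-* g p (p ^ t)))
      (lte-prime-power-exponent t (∥-geom-p p^[1+v]∥g))

  lte : ∀ {v g} m j → p ^ suc v ∥ g → p ^ m ∣ g * geom g j ⇔ p ^ (m ∸ suc v) ∣ j
  lte {v} {g} m j p^[1+v]∥g = mk⇔ to from
    where
    to : p ^ m ∣ g * geom g j → p ^ (m ∸ suc v) ∣ j
    to pᵐ∣ with m ≤? suc v
    ... | yes m≤1+v = subst (λ k → p ^ k ∣ j) (sym (m≤n⇒m∸n≡0 m≤1+v)) (1∣ j)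
    ... | no  m≰1+v = lte-exponent-divisible (m ∸ suc v) p^[1+v]∥g
                        (subst (λ k → p ^ k ∣ g * geom g j) (sym (m+[n∸m]≡n (≰⇒≥ m≰1+v))) pᵐ∣)
    from : p ^ (m ∸ suc v) ∣ j → p ^ m ∣ g * geom g j
    from (divides c refl) =
      subst (p ^ m ∣_) (trans (sym (geom-* g (p ^ t) c)) (cong (λ k → g * geom g k) (*-comm (p ^ t) c)))
      (∣-trans (^-monoʳ-∣ (m≤n+m∸n m (suc v))) (∣-trans (lte-prime-power-exponent t p^[1+v]∥g) (m∣m*n _)))
      where
      t : ℕ
      t = m ∸ suc v

  lte-truncated : ∀ {n v g} m j → p ∣ g → TruncatedValuation p n g v → m ≤ n →
    p ^ m ∣ g * geom g j ⇔ p ^ (m ∸ v) ∣ j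
  lte-truncated m j _ (inj₁ (refl , pⁿ∣g)) m≤n =
    mk⇔ (λ _ → subst (λ k → p ^ k ∣ j) (sym (m≤n⇒m∸n≡0 m≤n)) (1∣ j))
        (λ _ → ∣-trans (^-monoʳ-∣ m≤n) (∣-trans pⁿ∣g (m∣m*n _)))
  lte-truncated {v = suc v} m j _ (inj₂ (_ , p^[1+v]∥g)) _ = lte m j p^[1+v]∥g
  lte-truncated {v = zero}  m j p∣g (inj₂ (_ , exactly w refl p∤w)) _ =
    ⊥-elim (p∤w (subst (p ∣_) (*-identityˡ w) p∣g))

-- The order of α modulo pᵐ

module OrderModPrimePower (p : ℕ) (p-prime : Prime p) (p-odd : p % 2 ≡ 1)
  {α oᾱ : ℕ} (oᾱ-order : IsOrder p α oᾱ) {g : ℕ} (α^oᾱ≡1+g : α ^ oᾱ ≡ 1 + g)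
  {n vα : ℕ} (vα-valuation : TruncatedValuation p n g vα) where

  open PrimePower p p-prime
  open LiftingTheExponent p p-prime p-odd
  open Congruence p

  p∣g : p ∣ g
  p∣g = +≈⇒∣ 1 g (subst (_≈ 1) α^oᾱ≡1+g (^-order≈1 1<p oᾱ-order))

  α^[oᾱ*q] : ∀ q → α ^ (oᾱ * q) ≡ 1 + g * geom g q
  α^[oᾱ*q] q = trans (sym (^-*-assoc α oᾱ q)) (trans (cong (_^ q) α^oᾱ≡1+g) (^-geom g q))

  order-mod-pᵐ : ∀ {m d X} → 1 ≤ m → m ≤ n → α ^ d ≡ 1 + X → p ^ m ∣ X ⇔ oᾱ * p ^ (m ∸ vα) ∣ d
  order-mod-pᵐ {m} {d} {X} 1≤m m≤n α^d≡1+X = mk⇔ to from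
    where
    to : p ^ m ∣ X → oᾱ * p ^ (m ∸ vα) ∣ d
    to pᵐ∣X with order-∣ 1<p oᾱ-order d (subst (_≈ 1) (sym α^d≡1+X) (+-multiple-≈ 1 (∣-trans (p∣pᵐ 1≤m) pᵐ∣X)))
    ... | divides q refl = subst (oᾱ * p ^ (m ∸ vα) ∣_) (*-comm oᾱ q)
      (*-monoʳ-∣ oᾱ (Equivalence.to (lte-truncated m q p∣g vα-valuation m≤n) (subst (p ^ m ∣_) X≡ pᵐ∣X)))
      where
      X≡ : X ≡ g * geom g q
      X≡ = suc-injective (trans (sym α^d≡1+X) (trans (cong (α ^_) (*-comm q oᾱ)) (α^[oᾱ*q] q)))
    from : oᾱ * p ^ (m ∸ vα) ∣ d → p ^ m ∣ X
    from (divides c refl) = subst (p ^ m ∣_) (sym X≡) (Equivalence.from (lte-truncated m j p∣g vα-valuation m≤n) (n∣m*n c))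
      where
      j : ℕ
      j = c * p ^ (m ∸ vα)
      X≡ : X ≡ g * geom g j
      X≡ = suc-injective (trans (sym α^d≡1+X) (trans (cong (α ^_) (regroup c oᾱ _)) (α^[oᾱ*q] j)))
        where
        regroup : ∀ c o t → c * (o * t) ≡ o * (c * t)
        regroup c o t = trans (sym (*-assoc c o t)) (trans (cong (_* t) (*-comm c o)) (*-assoc o c t))

-- Orbits as products

length-cartesianProduct : ∀ {a b} {A : Set a} {B : Set b} (xs : List A) (ys : List B) →
  length (cartesianProduct xs ys) ≡ length xs * length ys
length-cartesianProduct []       ys = refl
length-cartesianProduct (x ∷ xs) ys =
  trans (length-++ (map (x ,_) ys)) (cong₂ _+_ (length-map (x ,_) ys) (length-cartesianProduct xs ys))

card-≡-length : (xs ys : List (ℕ × ℕ)) → Unique ys →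
  (∀ {z} → z ∈ xs → z ∈ ys) → (∀ {z} → z ∈ ys → z ∈ xs) → card xs ≡ length ys
card-≡-length xs ys ys! xs⊆ys ys⊆xs =
  ↭-length (∼bag⇒↭ (unique∧set⇒bag (deduplicate-! _≟²_ xs) ys!
    (mk⇔ (λ z∈ → xs⊆ys (∈-deduplicate⁻ _≟²_ xs z∈)) (λ z∈ → ∈-deduplicate⁺ _≟²_ (ys⊆xs z∈)))))
  where
  _≟²_ : DecidableEquality (ℕ × ℕ)
  _≟²_ = ≡-dec _≟_ _≟_

card-≡-* : (xs : List (ℕ × ℕ)) (F S : List ℕ) → Unique F → Unique S →
  (∀ {u v} → (u , v) ∈ xs → u ∈ F × v ∈ S) → (∀ {u v} → u ∈ F → v ∈ S → (u , v) ∈ xs) →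
  card xs ≡ length F * length S
card-≡-* xs F S F! S! xs⊆F×S F×S⊆xs = trans
  (card-≡-length xs (cartesianProduct F S) (Unique.cartesianProduct⁺ F! S!)
    (λ uv∈ → let (u∈ , v∈) = xs⊆F×S uv∈ in ∈-cartesianProduct⁺ u∈ v∈)
    (λ uv∈ → let (u∈ , v∈) = ∈-cartesianProduct⁻ F S uv∈ in F×S⊆xs u∈ v∈))
  (length-cartesianProduct F S)

∈-orbitD⁻ : ∀ {N α β oα x y u v} → (u , v) ∈ orbitD N α β oα x y →
  ∃[ k ] ∃[ a ] ∃[ b ] k < oα × a ∈ units N × b < N ×
    u ≡ (α ^ k * a * x + b * y) mod N × v ≡ (β ^ k * y) mod N
∈-orbitD⁻ {N} {oα = oα} uv∈ with find (∈-concatMap⁻ _ {xs = upTo oα} uv∈)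
... | k , k∈ , uv∈ₖ with find (∈-concatMap⁻ _ {xs = units N} uv∈ₖ)
... | a , a∈ , uv∈ₐ with ∈-map⁻ _ uv∈ₐ
... | b , b∈ , refl = k , a , b , ∈-upTo⁻ k∈ , a∈ , ∈-upTo⁻ b∈ , refl , refl

∈-orbitD⁺ : ∀ {N α β oα x y k a b} → k < oα → a ∈ units N → b < N →
  ((α ^ k * a * x + b * y) mod N , (β ^ k * y) mod N) ∈ orbitD N α β oα x y
∈-orbitD⁺ {N} {oα = oα} k< a∈ b< =
  ∈-concatMap⁺ _ {xs = upTo oα} (lose (∈-upTo⁺ k<) (∈-concatMap⁺ _ {xs = units N} (lose a∈ (∈-map⁺ _ (∈-upTo⁺ b<)))))

∈-orbitI⁻ : ∀ {N x y u v} → (u , v) ∈ orbitI N x y →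
  ∃[ a ] ∃[ b ] a ∈ units N × b < N × u ≡ (a * x + b * y) mod N × v ≡ y mod N
∈-orbitI⁻ {N} uv∈ with find (∈-concatMap⁻ _ {xs = units N} uv∈)
... | a , a∈ , uv∈ₐ with ∈-map⁻ _ uv∈ₐ
... | b , b∈ , refl = a , b , a∈ , ∈-upTo⁻ b∈ , refl , refl

∈-orbitI⁺ : ∀ {N x y a b} → a ∈ units N → b < N → ((a * x + b * y) mod N , y mod N) ∈ orbitI N x y
∈-orbitI⁺ {N} a∈ b< = ∈-concatMap⁺ _ {xs = units N} (lose a∈ (∈-map⁺ _ (∈-upTo⁺ b<)))

module _ (f : ℕ → ℕ) (T : ℕ) .{{_ : NonZero T}} (f≡⇔T∣ : ∀ {i j} → i ≤ j → f i ≡ f j ⇔ T ∣ j ∸ i) where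

  periodic : ∀ k → f k ≡ f (k % T)
  periodic k = sym (Equivalence.from (f≡⇔T∣ (m%n≤m k T)) (divides (k / T) k∸k%T≡))
    where
    k∸k%T≡ : k ∸ k % T ≡ k / T * T
    k∸k%T≡ = trans (cong (_∸ k % T) (m≡m%n+[m/n]*n k T)) (m+n∸m≡n (k % T) _)

  injective-below : ∀ {i j} → i < j → j < T → f i ≢ f j
  injective-below {i} {j} i<j j<T fi≡fj =
    <⇒≱ (≤-<-trans (m∸n≤m j i) j<T) (∣⇒≤ {{>-nonZero (m<n⇒0<n∸m i<j)}} (Equivalence.to (f≡⇔T∣ (<⇒≤ i<j)) fi≡fj))

module _ (N : ℕ) .{{_ : NonZero N}} (x y : ℕ) (F : List ℕ) (F! : Unique F) where

  card-orbitD : ∀ α β oα T .{{_ : NonZero T}} → T ≤ oα →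
    (∀ k a b → a ∈ units N → b < N → (α ^ k * a * x + b * y) % N ∈ F) →
    (∀ k u → u ∈ F → ∃[ a ] ∃[ b ] a ∈ units N × b < N × (α ^ k * a * x + b * y) % N ≡ u) →
    (∀ {i j} → i ≤ j → (β ^ i * y) % N ≡ (β ^ j * y) % N ⇔ T ∣ j ∸ i) →
    card (orbitD N α β oα x y) ≡ length F * T
  card-orbitD α β oα T T≤oα ∈F F⊆ f≡⇔T∣ =
    trans (card-≡-* (orbitD N α β oα x y) F (applyUpTo f T) F! (Unique.applyUpTo⁺₁ f T (injective-below f T f≡⇔T∣))
                    ⊆F×S F×S⊆)
      (cong (length F *_) (length-applyUpTo f T))
    where
    f : ℕ → ℕ
    f k = (β ^ k * y) % N
    ⊆F×S : ∀ {u v} → (u , v) ∈ orbitD N α β oα x y → u ∈ F × v ∈ applyUpTo f T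
    ⊆F×S uv∈ with ∈-orbitD⁻ {N} {α} {β} {oα} {x} {y} uv∈
    ... | k , a , b , _ , a∈ , b< , refl , refl =
      subst (_∈ F) (sym (mod≡% _ N)) (∈F k a b a∈ b<) ,
      subst (_∈ applyUpTo f T) (sym (trans (mod≡% _ N) (periodic f T f≡⇔T∣ k))) (∈-applyUpTo⁺ f (m%n<n k T))
    F×S⊆ : ∀ {u v} → u ∈ F → v ∈ applyUpTo f T → (u , v) ∈ orbitD N α β oα x y
    F×S⊆ u∈ v∈ with ∈-applyUpTo⁻ f v∈
    ... | k , k<T , refl with F⊆ k _ u∈
    ... | a , b , a∈ , b< , refl = subst₂ (λ s t → (s , t) ∈ orbitD N α β oα x y)
      (mod≡% _ N) (mod≡% _ N) (∈-orbitD⁺ {N} {α} {β} {oα} {x} {y} (<-≤-trans k<T T≤oα) a∈ b<)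

  card-orbitI : y < N →
    (∀ a b → a ∈ units N → b < N → (a * x + b * y) % N ∈ F) →
    (∀ u → u ∈ F → ∃[ a ] ∃[ b ] a ∈ units N × b < N × (a * x + b * y) % N ≡ u) →
    card (orbitI N x y) ≡ length F
  card-orbitI y<N ∈F F⊆ =
    trans (card-≡-* (orbitI N x y) F [ y ] F! (All.[] AllPairs.∷ AllPairs.[]) ⊆F×S F×S⊆) (*-identityʳ (length F))
    where
    y-reduced : y mod N ≡ y
    y-reduced = trans (mod≡% y N) (m<n⇒m%n≡m y<N)
    ⊆F×S : ∀ {u v} → (u , v) ∈ orbitI N x y → u ∈ F × v ∈ [ y ]
    ⊆F×S uv∈ with ∈-orbitI⁻ {N} {x} {y} uv∈
    ... | a , b , a∈ , b< , refl , refl = subst (_∈ F) (sym (mod≡% _ N)) (∈F a b a∈ b<) , here y-reduced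
    F×S⊆ : ∀ {u v} → u ∈ F → v ∈ [ y ] → (u , v) ∈ orbitI N x y
    F×S⊆ u∈ (here refl) with F⊆ _ u∈
    ... | a , b , a∈ , b< , refl = subst₂ (λ s t → (s , t) ∈ orbitI N x y)
      (mod≡% _ N) y-reduced (∈-orbitI⁺ {N} {x} {y} a∈ b<)

-- The orbit sizes

[m+n∸o]⊔m≡m+[n∸o] : ∀ m n o → (m + n ∸ o) ⊔ m ≡ m + (n ∸ o)
[m+n∸o]⊔m≡m+[n∸o] m n o with o ≤? n
... | yes o≤n = trans (cong (_⊔ m) (+-∸-assoc m o≤n)) (m≥n⇒m⊔n≡m (m≤m+n m (n ∸ o)))
... | no  o≰n = trans (m≤n⇒m⊔n≡n m+n∸o≤m) (sym (trans (cong (m +_) (m≤n⇒m∸n≡0 n≤o)) (+-identityʳ m)))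
  where
  n≤o : n ≤ o
  n≤o = <⇒≤ (≰⇒> o≰n)
  m+n∸o≤m : m + n ∸ o ≤ m
  m+n∸o≤m = ≤-trans (∸-monoʳ-≤ (m + n) n≤o) (≤-reflexive (m+n∸n≡m m n))

2*n∸v≡n+[n∸v] : ∀ n v → v ≤ n → 2 * n ∸ v ≡ n + (n ∸ v)
2*n∸v≡n+[n∸v] n v v≤n = trans (cong (λ k → n + k ∸ v) (+-identityʳ n)) (+-∸-assoc n v≤n)

max-exponent : ∀ n e v → (2 * suc n ∸ 1 ∸ v ∸ e) ⊔ n ≡ n + (suc n ∸ e ∸ v)
max-exponent n e v = begin
  (n + (suc n + 0) ∸ v ∸ e) ⊔ n   ≡⟨ cong (λ k → (n + k ∸ v ∸ e) ⊔ n) (+-identityʳ (suc n)) ⟩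
  (n + suc n ∸ v ∸ e) ⊔ n         ≡⟨ cong (_⊔ n) (trans (∸-+-assoc (n + suc n) v e) (cong (n + suc n ∸_) (+-comm v e))) ⟩
  (n + suc n ∸ (e + v)) ⊔ n       ≡⟨ [m+n∸o]⊔m≡m+[n∸o] n (suc n) (e + v) ⟩
  n + (suc n ∸ (e + v))           ≡⟨ cong (n +_) (∸-+-assoc (suc n) e v) ⟨
  n + (suc n ∸ e ∸ v)             ∎
  where open ≡-Reasoning

module Corollary (p : ℕ) (p-prime : Prime p) (p-odd : p mod 2 ≡ 1) (n : ℕ) {α β oα oᾱ x y : ℕ}
  (α⊥N : Coprime α (p ^ suc n)) (αβ≡1 : (α * β) mod (p ^ suc n) ≡ 1)
  (oα-order : IsOrder (p ^ suc n) α oα) (oᾱ-order : IsOrder p α oᾱ) (y<N : y < p ^ suc n) where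

  open PrimePower p p-prime
  open Residues n
  open Congruence N

  1<N : 1 < N
  1<N = ≤-trans 1<p (∣⇒≤ (p∣p^suc n))

  p∤α : ¬ p ∣ α
  p∤α = coprime-^⇒∤ n α⊥N

  open InverseOrbit N {α} {β} (Equivalence.to (mod≡1⇔%≡1% 1<N) αβ≡1)

  α^k≡1+[α^k∸1] : ∀ k → α ^ k ≡ 1 + (α ^ k ∸ 1)
  α^k≡1+[α^k∸1] k = sym (m+[n∸m]≡n (m^n>0 α {{≢-nonZero α≢0}} k))
    where
    α≢0 : α ≢ 0
    α≢0 refl = p∤α (p ∣0)

  g : ℕ
  g = α ^ oᾱ ∸ 1

  vα : ℕ
  vα = val p (suc n) ((α ^ oᾱ + (N ∸ 1)) mod N)

  vα-valuation : TruncatedValuation p (suc n) g vα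
  vα-valuation = subst (TruncatedValuation p (suc n) g) (cong (val p (suc n)) (sym reduced))
    (truncatedValuation-% p (suc n) (val-truncated p (suc n) (g % N)))
    where
    -- The statement writes α^oᾱ - 1 as α^oᾱ + (pⁿ - 1) to avoid truncated subtraction.
    reduced : (α ^ oᾱ + (N ∸ 1)) mod N ≡ g % N
    reduced = begin
      (α ^ oᾱ + N′) mod N   ≡⟨ mod≡% _ N ⟩
      (α ^ oᾱ + N′) % N     ≡⟨ cong (λ a → (a + N′) % N) (α^k≡1+[α^k∸1] oᾱ) ⟩
      (1 + g + N′) % N      ≡⟨ cong (_% N) (trans (+-comm (1 + g) N′) (trans (+-suc N′ g) (+-comm (suc N′) g))) ⟩
      (g + suc N′) % N      ≡⟨ cong (λ k → (g + k) % N) N≡1+N′ ⟨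
      (g + N) % N           ≡⟨ [m+n]%n≡m%n g N ⟩
      g % N                 ∎
      where open ≡-Reasoning

  open OrderModPrimePower p p-prime (trans (sym (mod≡% p 2)) p-odd) oᾱ-order (α^k≡1+[α^k∸1] oᾱ) vα-valuation

  T : ℕ → ℕ
  T m = oᾱ * p ^ (m ∸ vα)

  T≤oα : ∀ {m} → 1 ≤ m → m ≤ suc n → T m ≤ oα
  T≤oα 1≤m m≤1+n = ∣⇒≤ {{>-nonZero (proj₁ oα-order)}}
    (Equivalence.to (order-mod-pᵐ 1≤m m≤1+n (α^k≡1+[α^k∸1] oα)) (∣-trans (^-monoʳ-∣ m≤1+n) N∣α^oα∸1))
    where
    N∣α^oα∸1 : N ∣ α ^ oα ∸ 1
    N∣α^oα∸1 = +≈⇒∣ 1 _ (subst (_≈ 1) (α^k≡1+[α^k∸1] oα) (^-order≈1 1<N oα-order))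

  second-coordinates : ∀ {e} → e < suc n → p ^ e ∥ y →
    ∀ {i j} → i ≤ j → (β ^ i * y) % N ≡ (β ^ j * y) % N ⇔ T (suc n ∸ e) ∣ j ∸ i
  second-coordinates {e} e<1+n (exactly y′ y≡ p∤y′) {i} {j} i≤j =
    subst (λ y → (β ^ i * y) % N ≡ (β ^ j * y) % N ⇔ T m ∣ j ∸ i) (sym y≡)
      (⇔-trans (β-orbit≈⇔ {{m^n≢0 p e}} N≡pᵉpᵐ (∤⇒coprime-^ m p∤y′) i≤j (α^k≡1+[α^k∸1] (j ∸ i)))
               (order-mod-pᵐ (m<n⇒0<n∸m e<1+n) (m∸n≤m (suc n) e) (α^k≡1+[α^k∸1] (j ∸ i))))
    where
    m : ℕ
    m = suc n ∸ e
    N≡pᵉpᵐ : N ≡ p ^ e * p ^ m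
    N≡pᵉpᵐ = trans (cong (p ^_) (sym (m+[n∸m]≡n (<⇒≤ e<1+n)))) (^-distribˡ-+-* p e m)

  1∈units : 1 ∈ units N
  1∈units = ∈-units⁺ (suc n) 1<N p∤1

  0<N : 0 < N
  0<N = m^n>0 p (suc n)

  T≢0 : ∀ m → NonZero (T m)
  T≢0 m = m*n≢0 oᾱ (p ^ (m ∸ vα)) {{>-nonZero (proj₁ oᾱ-order)}} {{m^n≢0 p (m ∸ vα)}}

  first-coordinates-∈units : ¬ p ∣ x → p ∣ y →
    ∀ k a b → a ∈ units N → b < N → (α ^ k * a * x + b * y) % N ∈ units N
  first-coordinates-∈units p∤x p∣y k a b a∈ _ =
    ∤-+-∣∈units (∤-* (∤-* (∤-^ k p∤α) (proj₂ (∈-units⁻ n a∈))) p∤x) (∣n⇒∣m*n b p∣y)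

  first-coordinates-onto-units : ¬ p ∣ x →
    ∀ k u → u ∈ units N → ∃[ a ] ∃[ b ] a ∈ units N × b < N × (α ^ k * a * x + b * y) % N ≡ u
  first-coordinates-onto-units p∤x k u u∈ =
    let (a , a∈ , eq) = unit-reachable (∤-* (∤-^ k p∤α) p∤x) u∈
    in a , 0 , a∈ , 0<N , trans (cong (_% N) (regroup (α ^ k) a x y)) eq
    where
    regroup : ∀ c a x y → c * a * x + 0 * y ≡ a * (c * x)
    regroup = solve-∀

  first-coordinates-onto-residues : ¬ p ∣ y →
    ∀ k u → u ∈ upTo N → ∃[ a ] ∃[ b ] a ∈ units N × b < N × (α ^ k * a * x + b * y) % N ≡ u
  first-coordinates-onto-residues p∤y k u u∈ =
    let (b , b<N , eq) = residue-reachable p∤y (α ^ k * 1 * x) (∈-upTo⁻ u∈) in 1 , b , 1∈units , b<N , eq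

  card-orbitD-unit-y : val p (suc n) y ≡ 0 → card (orbitD N α β oα x y) ≡ oᾱ * p ^ (2 * suc n ∸ vα)
  card-orbitD-unit-y vy≡0 = begin
    card (orbitD N α β oα x y)                 ≡⟨ residues×orbit ⟩
    length (upTo N) * (oᾱ * p ^ (suc n ∸ vα))  ≡⟨ cong (_* (oᾱ * p ^ (suc n ∸ vα))) (length-upTo N) ⟩
    N * (oᾱ * p ^ (suc n ∸ vα))                ≡⟨ x*[y*z]≡y*[x*z] N oᾱ _ ⟩
    oᾱ * (N * p ^ (suc n ∸ vα))                ≡⟨ cong (oᾱ *_) (^-distribˡ-+-* p (suc n) (suc n ∸ vα)) ⟨
    oᾱ * p ^ (suc n + (suc n ∸ vα))            ≡⟨ cong (λ k → oᾱ * p ^ k) 2*[1+n]∸vα≡ ⟨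
    oᾱ * p ^ (2 * suc n ∸ vα)                  ∎
    where
    open ≡-Reasoning
    p∤y : ¬ p ∣ y
    p∤y = val≡0⇒∤ p n y vy≡0
    residues×orbit : card (orbitD N α β oα x y) ≡ length (upTo N) * T (suc n)
    residues×orbit = card-orbitD N x y (upTo N) (Unique.upTo⁺ N) α β oα (T (suc n)) {{T≢0 (suc n)}}
      (T≤oα (s≤s z≤n) ≤-refl) (λ _ _ _ _ _ → ∈-upTo⁺ (m%n<n _ N)) (first-coordinates-onto-residues p∤y)
      (second-coordinates (s≤s z≤n) (exactly y (sym (*-identityˡ y)) p∤y))
    2*[1+n]∸vα≡ : 2 * suc n ∸ vα ≡ suc n + (suc n ∸ vα)
    2*[1+n]∸vα≡ = 2*n∸v≡n+[n∸v] (suc n) vα (truncatedValuation-≤ vα-valuation)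
    x*[y*z]≡y*[x*z] : ∀ a b c → a * (b * c) ≡ b * (a * c)
    x*[y*z]≡y*[x*z] = solve-∀

  card-orbitD-unit-x : val p (suc n) x ≡ 0 → 0 < val p (suc n) y → val p (suc n) y < suc n →
    card (orbitD N α β oα x y) ≡ oᾱ * (p ∸ 1) * p ^ ((2 * suc n ∸ 1 ∸ vα ∸ val p (suc n) y) ⊔ n)
  card-orbitD-unit-x vx≡0 vy>0 vy<1+n = begin
    card (orbitD N α β oα x y)                         ≡⟨ units×orbit ⟩
    length (units N) * (oᾱ * p ^ (m ∸ vα))             ≡⟨ cong (_* (oᾱ * p ^ (m ∸ vα))) (length-units n) ⟩
    (p ∸ 1) * p ^ n * (oᾱ * p ^ (m ∸ vα))              ≡⟨ regroup (p ∸ 1) (p ^ n) oᾱ _ ⟩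
    oᾱ * (p ∸ 1) * (p ^ n * p ^ (m ∸ vα))              ≡⟨ cong (oᾱ * (p ∸ 1) *_) (^-distribˡ-+-* p n (m ∸ vα)) ⟨
    oᾱ * (p ∸ 1) * p ^ (n + (m ∸ vα))                  ≡⟨ cong (λ k → oᾱ * (p ∸ 1) * p ^ k) (max-exponent n e vα) ⟨
    oᾱ * (p ∸ 1) * p ^ ((2 * suc n ∸ 1 ∸ vα ∸ e) ⊔ n)  ∎
    where
    open ≡-Reasoning
    e m : ℕ
    e = val p (suc n) y
    m = suc n ∸ e
    p∤x : ¬ p ∣ x
    p∤x = val≡0⇒∤ p n x vx≡0
    units×orbit : card (orbitD N α β oα x y) ≡ length (units N) * T m
    units×orbit = card-orbitD N x y (units N) (units-unique N) α β oα (T m) {{T≢0 m}}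
      (T≤oα (m<n⇒0<n∸m vy<1+n) (m∸n≤m (suc n) e))
      (first-coordinates-∈units p∤x (val>0⇒∣ p (suc n) y vy>0)) (first-coordinates-onto-units p∤x)
      (second-coordinates vy<1+n (val<⇒∥ p (suc n) y vy<1+n))
    regroup : ∀ a b c d → a * b * (c * d) ≡ c * a * (b * d)
    regroup = solve-∀

  card-orbitD-zero-y : val p (suc n) x ≡ 0 → y ≡ 0 → card (orbitD N α β oα x y) ≡ (p ∸ 1) * p ^ n
  card-orbitD-zero-y vx≡0 y≡0 = begin
    card (orbitD N α β oα x y)  ≡⟨ units×orbit ⟩
    length (units N) * 1        ≡⟨ *-identityʳ _ ⟩
    length (units N)            ≡⟨ length-units n ⟩
    (p ∸ 1) * p ^ n             ∎
    where
    open ≡-Reasoning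
    p∤x : ¬ p ∣ x
    p∤x = val≡0⇒∤ p n x vx≡0
    βᵏy≡0 : ∀ k → (β ^ k * y) % N ≡ 0 % N
    βᵏy≡0 k = cong (_% N) (trans (cong (β ^ k *_) y≡0) (*-zeroʳ (β ^ k)))
    units×orbit : card (orbitD N α β oα x y) ≡ length (units N) * 1
    units×orbit = card-orbitD N x y (units N) (units-unique N) α β oα 1 (proj₁ oα-order)
      (first-coordinates-∈units p∤x (subst (p ∣_) (sym y≡0) (p ∣0))) (first-coordinates-onto-units p∤x)
      (λ {i} {j} _ → mk⇔ (λ _ → 1∣ (j ∸ i)) (λ _ → trans (βᵏy≡0 i) (sym (βᵏy≡0 j))))

  card-orbitI-unit-y : val p (suc n) y ≡ 0 → card (orbitI N x y) ≡ N
  card-orbitI-unit-y vy≡0 = trans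
    (card-orbitI N x y (upTo N) (Unique.upTo⁺ N) y<N (λ _ _ _ _ → ∈-upTo⁺ (m%n<n _ N)) residues-onto)
    (length-upTo N)
    where
    residues-onto : ∀ u → u ∈ upTo N → ∃[ a ] ∃[ b ] a ∈ units N × b < N × (a * x + b * y) % N ≡ u
    residues-onto u u∈ = let (b , b<N , eq) = residue-reachable (val≡0⇒∤ p n y vy≡0) (1 * x) (∈-upTo⁻ u∈)
                         in 1 , b , 1∈units , b<N , eq

  card-orbitI-unit-x : val p (suc n) x ≡ 0 → 0 < val p (suc n) y → card (orbitI N x y) ≡ (p ∸ 1) * p ^ n
  card-orbitI-unit-x vx≡0 vy>0 = trans
    (card-orbitI N x y (units N) (units-unique N) y<N
      (λ a b a∈ _ → ∤-+-∣∈units (∤-* (proj₂ (∈-units⁻ n a∈)) p∤x) (∣n⇒∣m*n b (val>0⇒∣ p (suc n) y vy>0)))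
      units-onto)
    (length-units n)
    where
    p∤x : ¬ p ∣ x
    p∤x = val≡0⇒∤ p n x vx≡0
    units-onto : ∀ u → u ∈ units N → ∃[ a ] ∃[ b ] a ∈ units N × b < N × (a * x + b * y) % N ≡ u
    units-onto u u∈ = let (a , a∈ , eq) = unit-reachable p∤x u∈
                      in a , 0 , a∈ , 0<N , trans (cong (_% N) (+-identityʳ (a * x))) eq

corollary6p5 : (p n α β oα oᾱ x y : ℕ) → Prime p → (p mod 2) ≡ 1 → 1 ≤ n →
  α < p ^ n → Coprime α (p ^ n) →
  β < p ^ n → ((α * β) mod (p ^ n)) ≡ 1 →
  IsOrder (p ^ n) α oα → IsOrder p α oᾱ →
  x < p ^ n → y < p ^ n → (val p n x ≡ 0 ⊎ val p n y ≡ 0) →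
  let vα = val p n (((α ^ oᾱ) + (p ^ n ∸ 1)) mod (p ^ n))
      cD = card (orbitD (p ^ n) α β oα x y)
      cI = card (orbitI (p ^ n) x y)
  in (val p n y ≡ 0 → cD ≡ oᾱ * p ^ (2 * n ∸ vα))
   × (val p n x ≡ 0 → 0 < val p n y → val p n y < n →
        cD ≡ oᾱ * (p ∸ 1) * p ^ ((2 * n ∸ 1 ∸ vα ∸ val p n y) ⊔ (n ∸ 1)))
   × (val p n x ≡ 0 → y ≡ 0 → cD ≡ (p ∸ 1) * p ^ (n ∸ 1))
   × (val p n y ≡ 0 → cI ≡ p ^ n)
   × (val p n x ≡ 0 → 0 < val p n y → cI ≡ (p ∸ 1) * p ^ (n ∸ 1))
corollary6p5 p zero    α β oα oᾱ x y _ _ ()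
corollary6p5 p (suc n) α β oα oᾱ x y p-prime p-odd _ _ α⊥N _ αβ≡1 oα-order oᾱ-order _ y<N _ =
  card-orbitD-unit-y , card-orbitD-unit-x , card-orbitD-zero-y , card-orbitI-unit-y , card-orbitI-unit-x
  where open Corollary p p-prime p-odd n α⊥N αβ≡1 oα-order oᾱ-order y<N
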